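{- Let $\mathcal{E}$ be the range of the map $f\colon\mathcal{S}\to\mathcal{S}$, $f\langle A,B,C\rangle=\langle \kappa\setminus A,\ \kappa\setminus(B\cup C),\ \kappa\setminus(A\cup B\cup C)\rangle$. Then $\mathcal{E}=\{\langle A,B,A\cap B\rangle : A,B\in\mathcal{F}(\kappa)\}$, and the map $\langle A,B,A\cap B\rangle\mapsto\langle A,B\rangle$ is an isomorphism from $\mathcal{E}$ (as a sublattice of $\mathcal{S}$) onto the Boolean lattice $\mathcal{F}(\kappa)\times\mathcal{F}(\kappa)$.
   Context: Let $\kappa$ be an infinite cardinal, identified with the set of ordinals less than $\kappa$. Let $\mathcal{F}(\kappa)=\{X\subseteq\kappa : X \text{ is finite or } \kappa\setminus X \text{ is finite}\}$. For subsets $A,B,C\subseteq\kappa$ put $\mu\langle A,B,C\rangle=(A\cap B)\cup(A\cap C)\cup(B\cap C)$ and $\overline{\langle A,B,C\rangle}=\langle A\cup\mu,\ B\cup\mu,\ C\cup\mu\rangle$ with $\mu=\mu\langle A,B,C\rangle$. A triple is balanced if $A\cap B=A\cap C=B\cap C$. $M_3[\mathcal{F}(\kappa)]$ is the lattice of balanced triples in $\mathcal{F}(\kappa)^3$, ordered componentwise, with meet the componentwise intersection and join $\langle A,B,C\rangle\vee\langle A',B',C'\rangle=\overline{\langle A\cup A',B\cup B',C\cup C'\rangle}$. Let $\mathcal{S}=\{\langle A,B,C\rangle\in M_3[\mathcal{F}(\kappa)] : C\setminus\mu\langle A,B,C\rangle\text{ is finite}\}$, a bounded sublattice of $M_3[\mathcal{F}(\kappa)]$.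 -}

module Defs where

open import Data.Bool using (Bool; true; false; _∧_; _∨_; not)
open import Data.List using (List)
open import Data.List.Membership.Propositional using (_∈_)
open import Data.Product using (Σ; _×_; _,_; proj₁; proj₂)
open import Data.Sum using (_⊎_)
open import Relation.Binary.PropositionalEquality using (_≡_)
open import Relation.Nullary using (¬_)

Infinite : Set → Set
Infinite K = ¬ (Σ (List K) λ xs → ∀ x → x ∈ xs)

module Sets (K : Set) where

  Sub : Set
  Sub = K → Bool

  infixr 7 _∩_
  infixr 6 _∪_

  _∩_ : Sub → Sub → Sub
  (X ∩ Y) x = X x ∧ Y x

  _∪_ : Sub → Sub → Sub
  (X ∪ Y) x = X x ∨ Y x

  ∁ : Sub → Sub
  ∁ X x = not (X x)

  _∖_ : Sub → Sub → Sub
  X ∖ Y = X ∩ ∁ Y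

  _≐_ : Sub → Sub → Set
  X ≐ Y = ∀ x → X x ≡ Y x

  Finite : Sub → Set
  Finite X = Σ (List K) λ xs → ∀ x → X x ≡ true → x ∈ xs

  InF : Sub → Set
  InF X = Finite X ⊎ Finite (∁ X)

  Triple : Set
  Triple = Sub × Sub × Sub

  _≋_ : Triple → Triple → Set
  (A , B , C) ≋ (A' , B' , C') = (A ≐ A') × (B ≐ B') × (C ≐ C')

  μ : Triple → Sub
  μ (A , B , C) = (A ∩ B) ∪ (A ∩ C) ∪ (B ∩ C)

  closure : Triple → Triple
  closure t@(A , B , C) = (A ∪ μ t , B ∪ μ t , C ∪ μ t)

  Balanced : Triple → Set
  Balanced (A , B , C) = ((A ∩ B) ≐ (A ∩ C)) × ((A ∩ C) ≐ (B ∩ C))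

  InM3 : Triple → Set
  InM3 t@(A , B , C) = InF A × InF B × InF C × Balanced t

  _⊓_ : Triple → Triple → Triple
  (A , B , C) ⊓ (A' , B' , C') = (A ∩ A' , B ∩ B' , C ∩ C')

  _⊔_ : Triple → Triple → Triple
  (A , B , C) ⊔ (A' , B' , C') = closure (A ∪ A' , B ∪ B' , C ∪ C')

  InS : Triple → Set
  InS t@(A , B , C) = InM3 t × Finite (C ∖ μ t)

  f : Triple → Triple
  f (A , B , C) = (∁ A , ∁ (B ∪ C) , ∁ (A ∪ B ∪ C))

  InE : Triple → Set
  InE e = Σ Triple λ t → InS t × (f t ≋ e)

  Pair : Set
  Pair = Sub × Sub

  _≈₂_ : Pair → Pair → Set
  (A , B) ≈₂ (A' , B') = (A ≐ A') × (B ≐ B')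

  _⊓₂_ : Pair → Pair → Pair
  (A , B) ⊓₂ (A' , B') = (A ∩ A' , B ∩ B')

  _⊔₂_ : Pair → Pair → Pair
  (A , B) ⊔₂ (A' , B') = (A ∪ A' , B ∪ B')

  g : Triple → Pair
  g (A , B , C) = (A , B)

-- By de Morgan, f⟨A,B,C⟩ = ⟨∁A, ∁(B∪C), ∁A ∩ ∁(B∪C)⟩, so the range of f consists of
-- "meet triples" ⟨A,B,A∩B⟩; conversely ⟨A,B,A∩B⟩ = f⟨∁A,∁B,∁A∩∁B⟩, and meet triples are
-- balanced with third component inside μ, hence lie in 𝓢. Meets of meet triples are meet
-- triples. The join of two of them is the closure of a triple whose third component lies
-- below the meet of the first two, and such a closure keeps the first two components and
-- replaces the third by their meet. So on 𝓔 both operations act on the first two components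
-- alone, and these determine the third.
module Submission where

open import Defs
open import Data.Product using (Σ; _×_; _,_; proj₁; proj₂)

open import Algebra.Bundles using (CommutativeMonoid)
open import Data.Bool using (true; false; _∧_; _∨_; not)
open import Data.Bool.Properties
  using (∧-conicalˡ; ∧-conicalʳ; ∧-inverseʳ; ∨-zeroʳ; ∨-comm; not-involutive; ∨-∧-booleanAlgebra; ∧-commutativeMonoid)
open import Algebra.Lattice.Properties.BooleanAlgebra ∨-∧-booleanAlgebra using (deMorgan₂)
open import Algebra.Properties.CommutativeSemigroup
  (CommutativeMonoid.commutativeSemigroup ∧-commutativeMonoid) using (interchange)
open import Data.List using ([]; _++_)
open import Data.List.Membership.Propositional using (_∈_)
open import Data.List.Membership.Propositional.Properties using (∈-++⁺ˡ; ∈-++⁺ʳ)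
open import Data.Sum using (inj₁; inj₂)
open import Relation.Binary.PropositionalEquality using (_≡_; refl; sym; trans; cong; cong₂)
open import Relation.Nullary using (contradiction)

module MeetTriples (K : Set) where
  open Sets K

  infix 4 _⊆_

  _⊆_ : Sub → Sub → Set
  X ⊆ Y = ∀ x → X x ≡ true → Y x ≡ true

  variable
    t t′ : Triple

  ≐⇒⊆ : ∀ X Y → X ≐ Y → X ⊆ Y
  ≐⇒⊆ X Y X≐Y x p = trans (sym (X≐Y x)) p

  ⊆-trans : ∀ X Y Z → X ⊆ Y → Y ⊆ Z → X ⊆ Z
  ⊆-trans X Y Z X⊆Y Y⊆Z x p = Y⊆Z x (X⊆Y x p)

  ∩-⊆ˡ : ∀ X Y → X ∩ Y ⊆ X
  ∩-⊆ˡ X Y x = ∧-conicalˡ (X x) (Y x)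

  ∩-⊆ʳ : ∀ X Y → X ∩ Y ⊆ Y
  ∩-⊆ʳ X Y x = ∧-conicalʳ (X x) (Y x)

  ⊆-∪ˡ : ∀ X Y → X ⊆ X ∪ Y
  ⊆-∪ˡ X Y x p = cong (_∨ Y x) p

  ⊆-∪ʳ : ∀ X Y → Y ⊆ X ∪ Y
  ⊆-∪ʳ X Y x p = trans (cong (X x ∨_) p) (∨-zeroʳ (X x))

  ∪-least : ∀ X Y Z → X ⊆ Z → Y ⊆ Z → X ∪ Y ⊆ Z
  ∪-least X Y Z X⊆Z Y⊆Z x p with X x in eq
  ... | true  = X⊆Z x eq
  ... | false = Y⊆Z x p

  ∩-mono : ∀ X X′ Y Y′ → X ⊆ X′ → Y ⊆ Y′ → X ∩ Y ⊆ X′ ∩ Y′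
  ∩-mono X X′ Y Y′ X⊆X′ Y⊆Y′ x p =
    cong₂ _∧_ (X⊆X′ x (∧-conicalˡ (X x) (Y x) p)) (Y⊆Y′ x (∧-conicalʳ (X x) (Y x) p))

  ∪-absorbs-⊆ : ∀ X Y → Y ⊆ X → (X ∪ Y) ≐ X
  ∪-absorbs-⊆ X Y Y⊆X x = absorb (X x) (Y x) (Y⊆X x)
    where
    absorb : ∀ a b → (b ≡ true → a ≡ true) → a ∨ b ≡ a
    absorb true  _     _   = refl
    absorb false false _   = refl
    absorb false true  b⇒a = sym (b⇒a refl)

  ∪-absorbsʳ-⊆ : ∀ X Y → Y ⊆ X → (Y ∪ X) ≐ X
  ∪-absorbsʳ-⊆ X Y Y⊆X x = trans (∨-comm (Y x) (X x)) (∪-absorbs-⊆ X Y Y⊆X x)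

  ∩-absorbs-⊇ : ∀ X Y → X ⊆ Y → (Y ∩ X) ≐ X
  ∩-absorbs-⊇ X Y X⊆Y x = absorb (Y x) (X x) (X⊆Y x)
    where
    absorb : ∀ a b → (b ≡ true → a ≡ true) → a ∧ b ≡ b
    absorb true  _     _   = refl
    absorb false false _   = refl
    absorb false true  b⇒a = b⇒a refl

  ∁-∪ : ∀ X Y → ∁ (X ∪ Y) ≐ (∁ X ∩ ∁ Y)
  ∁-∪ X Y x = deMorgan₂ (X x) (Y x)

  ∁-∁ : ∀ X → ∁ (∁ X) ≐ X
  ∁-∁ X x = not-involutive (X x)

  Finite-⊆ : ∀ {X Y} → X ⊆ Y → Finite Y → Finite X
  Finite-⊆ X⊆Y (xs , Y⊆xs) = xs , λ x p → Y⊆xs x (X⊆Y x p)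

  Finite-empty : ∀ {X} → (∀ x → X x ≡ false) → Finite X
  Finite-empty X≡∅ = [] , λ x p → contradiction (trans (sym (X≡∅ x)) p) λ ()

  Finite-∪ : ∀ {X Y} → Finite X → Finite Y → Finite (X ∪ Y)
  Finite-∪ {X} {Y} (xs , X⊆xs) (ys , Y⊆ys) = xs ++ ys , ⊆xs++ys
    where
    ⊆xs++ys : ∀ x → (X ∪ Y) x ≡ true → x ∈ xs ++ ys
    ⊆xs++ys x p with X x in eq
    ... | true  = ∈-++⁺ˡ (X⊆xs x eq)
    ... | false = ∈-++⁺ʳ xs (Y⊆ys x p)

  InF-cong : ∀ {X Y} → X ≐ Y → InF X → InF Y
  InF-cong X≐Y (inj₁ fin)   = inj₁ (Finite-⊆ (λ x p → trans (X≐Y x) p) fin)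
  InF-cong X≐Y (inj₂ cofin) = inj₂ (Finite-⊆ (λ x p → trans (cong not (X≐Y x)) p) cofin)

  InF-∁ : ∀ {X} → InF X → InF (∁ X)
  InF-∁ {X} (inj₁ fin)   = inj₂ (Finite-⊆ (≐⇒⊆ (∁ (∁ X)) X (∁-∁ X)) fin)
  InF-∁     (inj₂ cofin) = inj₁ cofin

  InF-∪ : ∀ {X Y} → InF X → InF Y → InF (X ∪ Y)
  InF-∪         (inj₁ fin)   (inj₁ fin′)   = inj₁ (Finite-∪ fin fin′)
  InF-∪ {X} {Y} (inj₂ cofin) _ =
    inj₂ (Finite-⊆ (⊆-trans _ (∁ X ∩ ∁ Y) _ (≐⇒⊆ _ _ (∁-∪ X Y)) (∩-⊆ˡ (∁ X) (∁ Y))) cofin)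
  InF-∪ {X} {Y} (inj₁ _) (inj₂ cofin′) =
    inj₂ (Finite-⊆ (⊆-trans _ (∁ X ∩ ∁ Y) _ (≐⇒⊆ _ _ (∁-∪ X Y)) (∩-⊆ʳ (∁ X) (∁ Y))) cofin′)

  InF-∩ : ∀ {X Y} → InF X → InF Y → InF (X ∩ Y)
  InF-∩ {X} {Y} fX fY = InF-cong ∁∁X∪∁Y≐X∩Y (InF-∁ (InF-∪ (InF-∁ fX) (InF-∁ fY)))
    where
    ∁∁X∪∁Y≐X∩Y : ∁ (∁ X ∪ ∁ Y) ≐ (X ∩ Y)
    ∁∁X∪∁Y≐X∩Y x = trans (∁-∪ (∁ X) (∁ Y) x) (cong₂ _∧_ (∁-∁ X x) (∁-∁ Y x))

  ≋-sym : t ≋ t′ → t′ ≋ t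
  ≋-sym (p , q , r) = (λ x → sym (p x)) , (λ x → sym (q x)) , (λ x → sym (r x))

  μ-below-meet : ∀ A B C → C ⊆ A ∩ B → μ (A , B , C) ≐ (A ∩ B)
  μ-below-meet A B C C⊆A∩B =
    ∪-absorbs-⊆ (A ∩ B) ((A ∩ C) ∪ (B ∩ C))
      (∪-least (A ∩ C) (B ∩ C) (A ∩ B)
        (⊆-trans (A ∩ C) C (A ∩ B) (∩-⊆ʳ A C) C⊆A∩B)
        (⊆-trans (B ∩ C) C (A ∩ B) (∩-⊆ʳ B C) C⊆A∩B))

  closure-below-meet : ∀ A B C → C ⊆ A ∩ B → closure (A , B , C) ≋ (A , B , A ∩ B)
  closure-below-meet A B C C⊆A∩B =
    absorbedInto A (∪-absorbs-⊆ A (A ∩ B) (∩-⊆ˡ A B)) ,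
    absorbedInto B (∪-absorbs-⊆ B (A ∩ B) (∩-⊆ʳ A B)) ,
    absorbedInto C (∪-absorbsʳ-⊆ (A ∩ B) C C⊆A∩B)
    where
    absorbedInto : ∀ X {Y} → (X ∪ (A ∩ B)) ≐ Y → (X ∪ μ (A , B , C)) ≐ Y
    absorbedInto X p x = trans (cong (X x ∨_) (μ-below-meet A B C C⊆A∩B x)) (p x)

  InMeet : Triple → Set
  InMeet (A , B , C) = InF A × InF B × (C ≐ (A ∩ B))

  InMeet-cong : t ≋ t′ → InMeet t → InMeet t′
  InMeet-cong (p , q , r) (fA , fB , C≐A∩B) =
    InF-cong p fA , InF-cong q fB ,
    λ x → trans (sym (r x)) (trans (C≐A∩B x) (cong₂ _∧_ (p x) (q x)))

  InMeet⇒InS : InMeet t → InS t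
  InMeet⇒InS {A , B , C} (fA , fB , C≐A∩B) =
    (fA , fB , InF-cong (λ x → sym (C≐A∩B x)) (InF-∩ fA fB) ,
     (λ x → sym (A∩C≐A∩B x)) , (λ x → trans (A∩C≐A∩B x) (sym (B∩C≐A∩B x)))) ,
    Finite-empty λ x → trans (cong (λ m → C x ∧ not m) (μ≐C x)) (∧-inverseʳ (C x))
    where
    within : ∀ X → A ∩ B ⊆ X → (X ∩ C) ≐ (A ∩ B)
    within X A∩B⊆X x = trans (cong (X x ∧_) (C≐A∩B x)) (∩-absorbs-⊇ (A ∩ B) X A∩B⊆X x)
    A∩C≐A∩B : (A ∩ C) ≐ (A ∩ B)
    A∩C≐A∩B = within A (∩-⊆ˡ A B)
    B∩C≐A∩B : (B ∩ C) ≐ (A ∩ B)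
    B∩C≐A∩B = within B (∩-⊆ʳ A B)
    μ≐C : μ (A , B , C) ≐ C
    μ≐C x = trans (μ-below-meet A B C (≐⇒⊆ C (A ∩ B) C≐A∩B) x) (sym (C≐A∩B x))

  meetTriple : Pair → Triple
  meetTriple (A , B) = (A , B , A ∩ B)

  InMeet⇒≋meetTriple : InMeet t → t ≋ meetTriple (g t)
  InMeet⇒≋meetTriple (_ , _ , C≐A∩B) = (λ _ → refl) , (λ _ → refl) , C≐A∩B

  InMeet-f : InS t → InMeet (f t)
  InMeet-f {A , B , C} ((fA , fB , fC , _) , _) =
    InF-∁ fA , InF-∁ (InF-∪ fB fC) , ∁-∪ A (B ∪ C)

  InS-f : InS t → InS (f t)
  InS-f tS = InMeet⇒InS (InMeet-f tS)

  InE⇒InMeet : InE t → InMeet t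
  InE⇒InMeet (_ , sS , fs≋t) = InMeet-cong fs≋t (InMeet-f sS)

  InMeet⇒InE : InMeet t → InE t
  InMeet⇒InE {A , B , C} (fA , fB , C≐A∩B) =
    meetTriple (∁ A , ∁ B) ,
    InMeet⇒InS (InF-∁ fA , InF-∁ fB , λ _ → refl) ,
    ∁-∁ A , second , third
    where
    second : ∁ (∁ B ∪ (∁ A ∩ ∁ B)) ≐ B
    second x = trans (cong not (∪-absorbs-⊆ (∁ B) (∁ A ∩ ∁ B) (∩-⊆ʳ (∁ A) (∁ B)) x)) (∁-∁ B x)
    third : ∁ (∁ A ∪ ∁ B ∪ (∁ A ∩ ∁ B)) ≐ C
    third x = trans (∁-∪ (∁ A) (∁ B ∪ (∁ A ∩ ∁ B)) x)
                    (trans (cong₂ _∧_ (∁-∁ A x) (second x)) (sym (C≐A∩B x)))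

  InMeet-⊓ : InMeet t → InMeet t′ → InMeet (t ⊓ t′)
  InMeet-⊓ {A , B , C} {A′ , B′ , C′} (fA , fB , C≐A∩B) (fA′ , fB′ , C′≐A′∩B′) =
    InF-∩ fA fA′ , InF-∩ fB fB′ ,
    λ x → trans (cong₂ _∧_ (C≐A∩B x) (C′≐A′∩B′ x)) (interchange (A x) (B x) (A′ x) (B′ x))

  ⊔-meetTriple : InMeet t → InMeet t′ → (t ⊔ t′) ≋ meetTriple (g t ⊔₂ g t′)
  ⊔-meetTriple {A , B , C} {A′ , B′ , C′} (_ , _ , C≐A∩B) (_ , _ , C′≐A′∩B′) =
    closure-below-meet (A ∪ A′) (B ∪ B′) (C ∪ C′)
      (∪-least C C′ ((A ∪ A′) ∩ (B ∪ B′))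
        (⊆-trans C (A ∩ B) _ (≐⇒⊆ C (A ∩ B) C≐A∩B)
          (∩-mono A (A ∪ A′) B (B ∪ B′) (⊆-∪ˡ A A′) (⊆-∪ˡ B B′)))
        (⊆-trans C′ (A′ ∩ B′) _ (≐⇒⊆ C′ (A′ ∩ B′) C′≐A′∩B′)
          (∩-mono A′ (A ∪ A′) B′ (B ∪ B′) (⊆-∪ʳ A A′) (⊆-∪ʳ B B′))))

  InMeet-⊔ : InMeet t → InMeet t′ → InMeet (t ⊔ t′)
  InMeet-⊔ mt@(fA , fB , _) mt′@(fA′ , fB′ , _) =
    InMeet-cong (≋-sym (⊔-meetTriple mt mt′)) (InF-∪ fA fA′ , InF-∪ fB fB′ , λ _ → refl)

  g-⊔ : InMeet t → InMeet t′ → g (t ⊔ t′) ≈₂ (g t ⊔₂ g t′)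
  g-⊔ mt mt′ = let (p , q , _) = ⊔-meetTriple mt mt′ in p , q

  g-injective : InMeet t → InMeet t′ → g t ≈₂ g t′ → t ≋ t′
  g-injective (_ , _ , C≐A∩B) (_ , _ , C′≐A′∩B′) (p , q) =
    p , q , λ x → trans (C≐A∩B x) (trans (cong₂ _∧_ (p x) (q x)) (sym (C′≐A′∩B′ x)))

lemma4p2 : (K : Set) → Infinite K → let open Sets K in
    (∀ t → InS t → InS (f t))
    × (∀ e → (InE e → Σ Sub λ A → Σ Sub λ B → InF A × InF B × (e ≋ (A , B , A ∩ B)))
    × ((Σ Sub λ A → Σ Sub λ B → InF A × InF B × (e ≋ (A , B , A ∩ B))) → InE e))
    × (∀ e e' → InE e → InE e' → InE (e ⊓ e') × InE (e ⊔ e'))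
    × (∀ e → InE e → InF (proj₁ (g e)) × InF (proj₂ (g e)))
    × (∀ e e' → InE e → InE e' → (g (e ⊓ e') ≈₂ (g e ⊓₂ g e')) × (g (e ⊔ e') ≈₂ (g e ⊔₂ g e')))
    × (∀ e e' → InE e → InE e' → g e ≈₂ g e' → e ≋ e')
    × (∀ A B → InF A → InF B → Σ Triple λ e → InE e × (g e ≈₂ (A , B)))
lemma4p2 K _ =
  (λ _ → InS-f) ,
  (λ e → (λ eE → let (fA , fB , _) = InE⇒InMeet eE in
                   proj₁ (g e) , proj₂ (g e) , fA , fB , InMeet⇒≋meetTriple (InE⇒InMeet eE)) ,
         (λ (A , B , fA , fB , e≋) →
            InMeet⇒InE (InMeet-cong (≋-sym e≋) (fA , fB , λ _ → refl)))) ,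
  (λ _ _ eE e′E → InMeet⇒InE (InMeet-⊓ (InE⇒InMeet eE) (InE⇒InMeet e′E)) ,
                  InMeet⇒InE (InMeet-⊔ (InE⇒InMeet eE) (InE⇒InMeet e′E))) ,
  (λ _ eE → let (fA , fB , _) = InE⇒InMeet eE in fA , fB) ,
  (λ _ _ eE e′E → ((λ _ → refl) , (λ _ → refl)) , g-⊔ (InE⇒InMeet eE) (InE⇒InMeet e′E)) ,
  (λ _ _ eE e′E → g-injective (InE⇒InMeet eE) (InE⇒InMeet e′E)) ,
  (λ A B fA fB → meetTriple (A , B) , InMeet⇒InE (fA , fB , λ _ → refl) ,
                 (λ _ → refl) , (λ _ → refl))
  where
  open Sets K
  open MeetTriples K
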